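{- For every $r\ge 2$ and all integers $k_0,\dots,k_{r-1}\ge 3$, \[ S(r;k_0,\dots,k_{r-1})\le R_r(k_0,\dots,k_{r-1})-1. \] In particular, for all integers $s,t,u\ge 3$, $S(3;s,t,u)\le R_3(s,t,u)-1$.
   Context: For an integer $k\ge 3$, let $\mathcal{L}(k)$ denote the linear equation $x_1+x_2+\cdots+x_{k-1}=x_k$ in positive integer variables. For integers $r\ge 1$ and $k_0,\dots,k_{r-1}\ge 3$, the generalized Schur number $S(r;k_0,\dots,k_{r-1})$ is the least positive integer $N$ such that for every coloring of $[1,N]=\{1,2,\dots,N\}$ with the $r$ colors $0,1,\dots,r-1$, there is some $i\in\{0,\dots,r-1\}$ and a solution $(x_1,\dots,x_{k_i})$ of $\mathcal{L}(k_i)$ with all $x_j\in[1,N]$ colored $i$. The multicolor Ramsey number $R_r(k_0,\dots,k_{r-1})$ is the least positive integer $n$ such that every coloring of the edges of the complete graph $K_n$ with colors $0,1,\dots,r-1$ contains, for some $i$, a complete subgraph on $k_i$ vertices all of whose edges have color $i$. -}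

module Defs where

open import Data.Nat using (ℕ; zero; suc; _+_; _∸_; _≤_)
open import Data.Fin using (Fin)
open import Data.Vec.Functional using (foldr)
open import Data.Product using (Σ; _×_; ∃)
open import Relation.Binary.PropositionalEquality using (_≡_; _≢_)

sumF : ∀ {m} → (Fin m → ℕ) → ℕ
sumF x = foldr _+_ 0 x

InRange : ℕ → ℕ → Set
InRange N x = 1 ≤ x × x ≤ N

-- A monochromatic (colour i under c) solution of L(k): x₁+…+x_{k-1} = x_k,
-- all variables in [1,N].  The first k-1 variables are xs, the last is y.
MonoSolution : ∀ {r} → ℕ → (ℕ → Fin r) → Fin r → ℕ → Set
MonoSolution N c i k =
  Σ (Fin (k ∸ 1) → ℕ) λ xs → Σ ℕ λ y →
    ((j : Fin (k ∸ 1)) → InRange N (xs j) × c (xs j) ≡ i) ×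
    InRange N y × c y ≡ i ×
    sumF xs ≡ y

-- every r-colouring of [1,N] has, for some i, a solution of L(kᵢ) in colour i
-- (colourings are functions ℕ → Fin r; only their values on [1,N] matter)
SchurProperty : (r : ℕ) → (Fin r → ℕ) → ℕ → Set
SchurProperty r k N =
  (c : ℕ → Fin r) → ∃ λ (i : Fin r) → MonoSolution N c i (k i)

-- every symmetric r-colouring of the edges of K_n contains, for some i,
-- a kᵢ-clique all of whose edges have colour i
-- (an edge colouring is c : Fin n → Fin n → Fin r with c u v ≡ c v u;
--  diagonal values are irrelevant)
RamseyProperty : (r : ℕ) → (Fin r → ℕ) → ℕ → Set
RamseyProperty r k n =
  (c : Fin n → Fin n → Fin r) → (∀ u v → c u v ≡ c v u) →
  ∃ λ (i : Fin r) → Σ (Fin (k i) → Fin n) λ f →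
    (∀ a b → a ≢ b → f a ≢ f b) ×
    (∀ a b → a ≢ b → c (f a) (f b) ≡ i)

IsLeastPositive : (ℕ → Set) → ℕ → Set
IsLeastPositive P n = 1 ≤ n × P n × (∀ m → 1 ≤ m → P m → n ≤ m)

IsSchurNumber : (r : ℕ) → (Fin r → ℕ) → ℕ → Set
IsSchurNumber r k = IsLeastPositive (SchurProperty r k)

IsRamseyNumber : (r : ℕ) → (Fin r → ℕ) → ℕ → Set
IsRamseyNumber r k = IsLeastPositive (RamseyProperty r k)

{-# OPTIONS --safe #-}
-- Colour the edge {u, v} of K_R, on the vertices 0, …, R - 1, by the colour of ∣ u - v ∣.
-- A clique v₀ < ⋯ < v_{k-1} of colour i gives the solution x_j = v_j - v_{j-1} (1 ≤ j < k),
-- x_k = v_{k-1} - v₀ of L(k) in colour i inside [1, R - 1], so every colouring of [1, R - 1]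
-- has a monochromatic solution. A least such bound exists because the property is decidable:
-- a colouring of ℕ matters only on [0, N], and each colour class admits finitely many
-- candidate solutions.
module Submission where

open import Defs
open import Data.Nat using (ℕ; zero; suc; _+_; _∸_; _≤_; _<_; s≤s; ∣_-_∣; _≤?_; _≟_)
open import Data.Nat.Properties
open import Data.Nat.Induction using (<-rec)
open import Data.Fin as Fin using (Fin; inject₁; fromℕ; toℕ; punchIn)
open import Data.Fin.Properties
  using (¬Fin0; toℕ-injective; toℕ<n; punchIn-injective; punchInᵢ≢i; any?; all?)
  renaming (_≟_ to _≟ᶠ_)
open import Data.Vec.Functional using (_∷_)
open import Data.Product using (_×_; ∃; _,_; proj₁; proj₂)
open import Data.Empty using (⊥-elim)
open import Function using (_∘_)
open import Function.Definitions using (Injective)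
open import Relation.Nullary using (Dec; yes; no; contradiction)
open import Relation.Nullary.Decidable using (map′; _×-dec_)
open import Relation.Unary using (Decidable)
open import Relation.Binary.Definitions using (DecidableEquality)
open import Relation.Binary.PropositionalEquality

private
  variable
    n r : ℕ

distinct⇒injective : ∀ {A B : Set} {f : A → B} → DecidableEquality A →
  (∀ a b → a ≢ b → f a ≢ f b) → Injective _≡_ _≡_ f
distinct⇒injective _≟_ distinct {a} {b} fa≡fb with a ≟ b
... | yes a≡b = a≡b
... | no  a≢b = contradiction fa≡fb (distinct a b a≢b)

argmin : (f : Fin (suc n) → ℕ) → ∃ λ m → ∀ a → f m ≤ f a
argmin {zero}  f = Fin.zero , λ { Fin.zero → ≤-refl }
argmin {suc n} f with argmin (f ∘ Fin.suc)
... | m , min with f Fin.zero ≤? f (Fin.suc m)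
...   | yes f₀≤ = Fin.zero , λ { Fin.zero → ≤-refl ; (Fin.suc a) → ≤-trans f₀≤ (min a) }
...   | no  f₀≰ = Fin.suc m , λ { Fin.zero → <⇒≤ (≰⇒> f₀≰) ; (Fin.suc a) → min a }

StrictlyIncreasing : (Fin (suc n) → ℕ) → Set
StrictlyIncreasing {n} g = (j : Fin n) → g (inject₁ j) < g (Fin.suc j)

sortedEnumeration : (f : Fin (suc n) → ℕ) → Injective _≡_ _≡_ f →
  ∃ λ (g : Fin (suc n) → ℕ) → StrictlyIncreasing g × (∀ a → ∃ λ b → g a ≡ f b)
sortedEnumeration {zero}  f _   = f , (λ ()) , λ a → a , refl
sortedEnumeration {suc n} f inj with argmin f
... | m , min with sortedEnumeration (f ∘ punchIn m) (punchIn-injective m _ _ ∘ inj)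
...   | g , increasing , gFromF = f m ∷ g , increasing′ , fromF
  where
  min<rest : ∀ a → f m < f (punchIn m a)
  min<rest a = ≤∧≢⇒< (min _) (punchInᵢ≢i m a ∘ sym ∘ inj)

  increasing′ : StrictlyIncreasing (f m ∷ g)
  increasing′ Fin.zero with gFromF Fin.zero
  ... | b , g₀≡ = subst (f m <_) (sym g₀≡) (min<rest b)
  increasing′ (Fin.suc j) = increasing j

  fromF : ∀ a → ∃ λ b → (f m ∷ g) a ≡ f b
  fromF Fin.zero    = m , refl
  fromF (Fin.suc a) = let b , ga≡ = gFromF a in punchIn m b , ga≡

gaps : (Fin (suc n) → ℕ) → Fin n → ℕ
gaps g j = g (Fin.suc j) ∸ g (inject₁ j)

gaps-telescope : (g : Fin (suc n) → ℕ) → (∀ j → g (inject₁ j) ≤ g (Fin.suc j)) →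
  sumF (gaps g) + g Fin.zero ≡ g (fromℕ n)
gaps-telescope {zero}  g mono = refl
gaps-telescope {suc n} g mono = begin
  (d + s) + g₀   ≡⟨ cong (_+ g₀) (+-comm d s) ⟩
  (s + d) + g₀   ≡⟨ +-assoc s d g₀ ⟩
  s + (d + g₀)   ≡⟨ cong (s +_) (m∸n+n≡m (mono Fin.zero)) ⟩
  s + g₁         ≡⟨ gaps-telescope (g ∘ Fin.suc) (mono ∘ Fin.suc) ⟩
  g (fromℕ (suc n)) ∎
  where
  open ≡-Reasoning
  g₀ g₁ d s : ℕ
  g₀ = g Fin.zero
  g₁ = g (Fin.suc Fin.zero)
  d  = g₁ ∸ g₀
  s  = sumF (gaps (g ∘ Fin.suc))

increasingChain⇒monoSolution : ∀ {N} (c : ℕ → Fin r) (i : Fin r) (g : Fin (2 + n) → ℕ) →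
  StrictlyIncreasing g → (∀ p → g p ≤ N) →
  (∀ p q → g q < g p → c (g p ∸ g q) ≡ i) →
  MonoSolution N c i (2 + n)
increasingChain⇒monoSolution {n = n} c i g increasing bound colour =
  gaps g , sumF (gaps g) ,
  (λ j → (gap-positive j , ≤-trans (m∸n≤m _ (g (inject₁ j))) (bound _)) ,
         colour _ _ (increasing j)) ,
  (sum-positive , ≤-trans (subst (sumF (gaps g) ≤_) telescope (m≤m+n _ _)) (bound _)) ,
  subst (λ y → c y ≡ i) last∸first≡sum (colour _ _ first<last) , refl
  where
  telescope : sumF (gaps g) + g Fin.zero ≡ g (fromℕ (suc n))
  telescope = gaps-telescope g (<⇒≤ ∘ increasing)

  gap-positive : ∀ j → 1 ≤ gaps g j
  gap-positive j = m<n⇒0<n∸m (increasing j)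

  sum-positive : 1 ≤ sumF (gaps g)
  sum-positive = ≤-trans (gap-positive Fin.zero) (m≤m+n _ _)

  first<last : g Fin.zero < g (fromℕ (suc n))
  first<last = subst (g Fin.zero <_) telescope (+-monoˡ-≤ (g Fin.zero) sum-positive)

  last∸first≡sum : g (fromℕ (suc n)) ∸ g Fin.zero ≡ sumF (gaps g)
  last∸first≡sum =
    trans (cong (_∸ g Fin.zero) (sym telescope)) (m+n∸n≡m (sumF (gaps g)) (g Fin.zero))

clique⇒monoSolution : ∀ {R} (c : ℕ → Fin r) i K → 2 ≤ K → (f : Fin K → Fin R) →
  (∀ a b → a ≢ b → f a ≢ f b) → (∀ a b → a ≢ b → c ∣ toℕ (f a) - toℕ (f b) ∣ ≡ i) →
  MonoSolution (R ∸ 1) c i K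
clique⇒monoSolution c i (suc zero) (s≤s ())
clique⇒monoSolution {R = R} c i (suc (suc n)) _ f distinct clique
  with sortedEnumeration (toℕ ∘ f)
         (distinct⇒injective _≟ᶠ_ λ a b a≢b → distinct a b a≢b ∘ toℕ-injective)
... | g , increasing , fromF = increasingChain⇒monoSolution c i g increasing bound colour
  where

  bound : ∀ p → g p ≤ R ∸ 1
  bound p with fromF p
  ... | b , gp≡ = subst (_≤ R ∸ 1) (sym gp≡) (∸-monoˡ-≤ 1 (toℕ<n (f b)))

  colour : ∀ p q → g q < g p → c (g p ∸ g q) ≡ i
  colour p q gq<gp with fromF p | fromF q
  ... | a , gp≡ | b , gq≡ = begin
    c (g p ∸ g q)                 ≡⟨ cong c (sym (m≤n⇒∣n-m∣≡n∸m (<⇒≤ gq<gp))) ⟩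
    c ∣ g p - g q ∣               ≡⟨ cong₂ (λ u v → c ∣ u - v ∣) gp≡ gq≡ ⟩
    c ∣ toℕ (f a) - toℕ (f b) ∣   ≡⟨ clique a b a≢b ⟩
    i                             ∎
    where
    open ≡-Reasoning
    a≢b : a ≢ b
    a≢b refl = <-irrefl (trans gq≡ (sym gp≡)) gq<gp

ramsey⇒schur : (k : Fin r → ℕ) → (∀ i → 2 ≤ k i) → ∀ R →
  RamseyProperty r k R → SchurProperty r k (R ∸ 1)
ramsey⇒schur k k≥2 R ramsey c
  with ramsey (λ u v → c ∣ toℕ u - toℕ v ∣) (λ u v → cong c (∣-∣-comm (toℕ u) (toℕ v)))
... | i , f , distinct , clique = i , clique⇒monoSolution c i (k i) (k≥2 i) f distinct clique

∃-summands? : {A B : ℕ → Set} (N : ℕ) → (∀ {x} → A x → x ≤ N) → Decidable A → Decidable B →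
  ∀ m → Dec (∃ λ (xs : Fin m → ℕ) → (∀ j → A (xs j)) × B (sumF xs))
∃-summands? N bounded A? B? zero = map′ (λ b → (λ ()) , (λ ()) , b) (proj₂ ∘ proj₂) (B? 0)
∃-summands? {A} {B} N bounded A? B? (suc m) =
  map′ cons uncons
    (anyUpTo? (λ x → A? x ×-dec ∃-summands? N bounded A? (B? ∘ (x +_)) m) (suc N))
  where
  Summands : ∀ m → (ℕ → Set) → Set
  Summands m B′ = ∃ λ (xs : Fin m → ℕ) → (∀ j → A (xs j)) × B′ (sumF xs)

  cons : (∃ λ x → x < suc N × A x × Summands m (B ∘ (x +_))) → Summands (suc m) B
  cons (x , _ , ax , xs , axs , b) = x ∷ xs , (λ { Fin.zero → ax ; (Fin.suc j) → axs j }) , b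

  uncons : Summands (suc m) B → ∃ λ x → x < suc N × A x × Summands m (B ∘ (x +_))
  uncons (xs , axs , b) =
    xs Fin.zero , s≤s (bounded (axs Fin.zero)) , axs Fin.zero , xs ∘ Fin.suc , axs ∘ Fin.suc , b

monoSolution? : ∀ N (c : ℕ → Fin r) i k → Dec (MonoSolution N c i k)
monoSolution? N c i k =
  map′ (λ { (xs , good , inRange , colour) → xs , sumF xs , good , inRange , colour , refl })
       (λ { (xs , _ , good , inRange , colour , refl) → xs , good , inRange , colour })
       (∃-summands? N (proj₂ ∘ proj₁) good? good? (k ∸ 1))
  where
  good? : Decidable (λ x → InRange N x × c x ≡ i)
  good? x = ((1 ≤? x) ×-dec (x ≤? N)) ×-dec (c x ≟ᶠ i)

monoSolution-local : ∀ {N k} {c c′ : ℕ → Fin r} {i} → (∀ {x} → x < suc N → c x ≡ c′ x) →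
  MonoSolution N c i k → MonoSolution N c′ i k
monoSolution-local {N = N} {c = c} {c′} {i} agree (xs , y , good , inRange , colour , sum) =
  xs , y , (λ j → proj₁ (good j) , recolour (proj₁ (good j)) (proj₂ (good j))) ,
  inRange , recolour inRange colour , sum
  where
  recolour : ∀ {x} → InRange N x → c x ≡ i → c′ x ≡ i
  recolour (_ , x≤N) cx≡i = trans (sym (agree (s≤s x≤N))) cx≡i

_[_≔_] : (ℕ → Fin r) → ℕ → Fin r → ℕ → Fin r
(c [ n ≔ a ]) x with x ≟ n
... | yes _ = a
... | no  _ = c x

[≔]-cong : ∀ {c c′ : ℕ → Fin r} a → (∀ {x} → x < n → c x ≡ c′ x) →
  ∀ {x} → x < suc n → (c [ n ≔ a ]) x ≡ (c′ [ n ≔ a ]) x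
[≔]-cong {n = n} a agree {x} x<1+n with x ≟ n
... | yes _   = refl
... | no  x≢n = agree (≤∧≢⇒< (≤-pred x<1+n) x≢n)

[≔]-self : ∀ (c : ℕ → Fin r) n x → (c [ n ≔ c n ]) x ≡ c x
[≔]-self c n x with x ≟ n
... | yes refl = refl
... | no  _    = refl

DependsOnlyBelow : ℕ → ((ℕ → Fin r) → Set) → Set
DependsOnlyBelow n Q = ∀ {c c′} → (∀ {x} → x < n → c x ≡ c′ x) → Q c → Q c′

allColourings? : ∀ n {Q : (ℕ → Fin r) → Set} → DependsOnlyBelow n Q → (∀ c → Dec (Q c)) →
  Dec (∀ c → Q c)
allColourings? {zero}  zero    _     _  = yes λ c → ⊥-elim (¬Fin0 (c 0))
allColourings? {suc r} zero    local Q? =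
  map′ (λ q c → local (λ ()) q) (λ all → all (λ _ → Fin.zero)) (Q? (λ _ → Fin.zero))
allColourings? (suc n) local Q? =
  map′ (λ all c → local (λ {x} _ → [≔]-self c n x) (all (c n) c))
       (λ all a c → all (c [ n ≔ a ]))
       (all? λ a → allColourings? n (λ agree → local ([≔]-cong a agree))
                                    (λ c → Q? (c [ n ≔ a ])))

schurProperty? : ∀ r (k : Fin r → ℕ) N → Dec (SchurProperty r k N)
schurProperty? r k N =
  allColourings? (suc N) (λ agree (i , sol) → i , monoSolution-local {k = k i} agree sol)
    (λ c → any? λ i → monoSolution? N c i (k i))

Minimal : (ℕ → Set) → ℕ → Set
Minimal P m = P m × (∀ n → P n → m ≤ n)

minimal : {P : ℕ → Set} → Decidable P → P n → ∃ (Minimal P)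
minimal {n = n} {P = P} P? = <-rec (λ n → P n → ∃ (Minimal P)) step n
  where
  step : ∀ n → (∀ {m} → m < n → P m → ∃ (Minimal P)) → P n → ∃ (Minimal P)
  step n rec pn with anyUpTo? P? n
  ... | yes (m , m<n , pm) = rec m<n pm
  ... | no none            = n , pn , λ m pm → ≮⇒≥ λ m<n → none (m , m<n , pm)

leastPositive : {P : ℕ → Set} → Decidable P → 1 ≤ n → P n →
  ∃ λ m → IsLeastPositive P m × m ≤ n
leastPositive {n = n} P? 1≤n pn with minimal (λ m → 1 ≤? m ×-dec P? m) (1≤n , pn)
... | m , (1≤m , pm) , least =
  m , (1≤m , pm , λ m′ 1≤m′ pm′ → least m′ (1≤m′ , pm′)) , least n (1≤n , pn)

schurProperty⇒positive : (k : Fin (suc r) → ℕ) → ∀ {N} → SchurProperty (suc r) k N → 1 ≤ N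
schurProperty⇒positive k schur with schur (λ _ → Fin.zero)
... | _ , _ , _ , _ , (1≤y , y≤N) , _ = ≤-trans 1≤y y≤N

theorem4p1 : (r : ℕ) → 2 ≤ r → (k : Fin r → ℕ) → (∀ i → 3 ≤ k i) →
    (R : ℕ) → IsRamseyNumber r k R →
    ∃ λ (S : ℕ) → IsSchurNumber r k S × S ≤ R ∸ 1
theorem4p1 zero    ()
theorem4p1 (suc r) _ k k≥3 R (_ , ramsey , _) =
  leastPositive (schurProperty? (suc r) k) (schurProperty⇒positive k schur) schur
  where
  schur : SchurProperty (suc r) k (R ∸ 1)
  schur = ramsey⇒schur k (<⇒≤ ∘ k≥3) R ramsey
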